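{- Let $G$ be a single-sink DAG and let $\mathrm{Mold}(G)$ be its molding with special source $s$. Then (1) the persistent pebbling price of $\mathrm{Mold}(G)$ is at most the persistent pebbling price of $G$ plus $2$; and (2) every visiting pebbling $P'_0,P'_1,\dots,P'_\tau$ of $\mathrm{Mold}(G)$ contains a configuration $P'_b$ ($0\le b\le\tau$) with at least $\mathrm{vis}(G)+2$ pebbles and with $s\in P'_b$, where $\mathrm{vis}(G)$ is the visiting price of $G$.
   Context: The molding $\mathrm{Mold}(G)$ of a DAG $G$ has vertex set $\{s\}\cup\{v^{\mathrm{in}},v^{\mathrm{out}}: v\in V(G)\}$ and edges $(v^{\mathrm{in}},v^{\mathrm{out}})$ for every $v\in V(G)$, $(u^{\mathrm{out}},v^{\mathrm{in}})$ for every edge $(u,v)$ of $G$, and $(s,v^{\mathrm{out}})$ for every $v\in V(G)$. If $G$ has unique sink $z$, then $\mathrm{Mold}(G)$ has unique sink $z^{\mathrm{out}}$. A reversible pebbling is a sequence of vertex sets $P_0,\dots,P_\tau$, each obtained from the previous by placing a pebble on $v\notin P$ with all predecessors of $v$ in $P$, or removing a pebble from $v\in P$ with all predecessors of $v$ in $P$; its space is $\max_t|P_t|$. For a DAG with unique sink $z$: a visiting pebbling is a reversible pebbling with $P_0=\emptyset$ and $z\in P_\tau$; the visiting price is the minimum space of a visiting pebbling; the persistent pebbling price is the minimum space of a reversible pebbling with $P_0=\emptyset$ and $P_\tau=\{z\}$. -}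

module Defs where

open import Data.Nat using (ℕ; zero; suc; _+_; _≤_; _<_)
open import Data.Bool using (Bool; true; false; not; if_then_else_)
open import Data.List using (List; _∷_; []; map; _++_)
open import Data.Nat.ListAction using (sum)
open import Data.Fin using (Fin)
open import Data.List using (allFin) renaming (map to lmap)
open import Data.Product using (Σ; ∃; _×_; _,_)
open import Relation.Nullary using (¬_)
open import Relation.Binary.PropositionalEquality using (_≡_; _≢_)
open import Relation.Binary.Construct.Closure.Transitive using (TransClosure)

Acyclic : {V : Set} → (V → V → Set) → Set
Acyclic {V} E = ∀ (v : V) → ¬ TransClosure E v v

IsSink : {V : Set} → (V → V → Set) → V → Set
IsSink {V} E z = ∀ (w : V) → ¬ E z w

UniqueSink : {V : Set} → (V → V → Set) → V → Set
UniqueSink {V} E z = IsSink E z × (∀ (v : V) → IsSink E v → v ≡ z)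

-- Pebbling on a graph with vertex type V, edge relation E,
-- and a duplicate-free complete enumeration of V (used for counting).

Config : Set → Set
Config V = V → Bool

size : {V : Set} → List V → Config V → ℕ
size enum P = sum (map (λ v → if P v then 1 else 0) enum)

Step : {V : Set} → (V → V → Set) → Config V → Config V → Set
Step {V} E P Q = Σ V λ v →
    (∀ u → E u v → P u ≡ true)
  × (Q v ≡ not (P v))
  × (∀ w → w ≢ v → Q w ≡ P w)

IsPebbling : {V : Set} → (V → V → Set) → ℕ → (ℕ → Config V) → Set
IsPebbling E τ P = ∀ t → t < τ → Step E (P t) (P (suc t))

EmptyConf : {V : Set} → Config V → Set
EmptyConf {V} P = ∀ (v : V) → P v ≡ false

SpaceAtMost : {V : Set} → List V → ℕ → (ℕ → Config V) → ℕ → Set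
SpaceAtMost enum τ P k = ∀ t → t ≤ τ → size enum (P t) ≤ k

IsVisitingPebbling : {V : Set} → (V → V → Set) → V → ℕ → (ℕ → Config V) → Set
IsVisitingPebbling E z τ P = IsPebbling E τ P × EmptyConf (P 0) × P τ z ≡ true

IsPersistentPebbling : {V : Set} → (V → V → Set) → V → ℕ → (ℕ → Config V) → Set
IsPersistentPebbling {V} E z τ P =
  IsPebbling E τ P × EmptyConf (P 0) × P τ z ≡ true × (∀ (v : V) → P τ v ≡ true → v ≡ z)

HasVisitingPebbling : {V : Set} → (V → V → Set) → List V → V → ℕ → Set
HasVisitingPebbling {V} E enum z k =
  Σ ℕ λ τ → Σ (ℕ → Config V) λ P → IsVisitingPebbling E z τ P × SpaceAtMost enum τ P k

HasPersistentPebbling : {V : Set} → (V → V → Set) → List V → V → ℕ → Set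
HasPersistentPebbling {V} E enum z k =
  Σ ℕ λ τ → Σ (ℕ → Config V) λ P → IsPersistentPebbling E z τ P × SpaceAtMost enum τ P k

IsVisitingPrice : {V : Set} → (V → V → Set) → List V → V → ℕ → Set
IsVisitingPrice E enum z p =
  HasVisitingPebbling E enum z p × (∀ k → HasVisitingPebbling E enum z k → p ≤ k)

IsPersistentPrice : {V : Set} → (V → V → Set) → List V → V → ℕ → Set
IsPersistentPrice E enum z p =
  HasPersistentPebbling E enum z p × (∀ k → HasPersistentPebbling E enum z k → p ≤ k)

data MoldV (n : ℕ) : Set where
  src  : MoldV n
  vin  : Fin n → MoldV n
  vout : Fin n → MoldV n

data MoldE {n : ℕ} (E : Fin n → Fin n → Set) : MoldV n → MoldV n → Set where
  in-out : ∀ v → MoldE E (vin v) (vout v)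
  lift   : ∀ {u v} → E u v → MoldE E (vout u) (vin v)
  from-s : ∀ v → MoldE E src (vout v)

moldEnum : (n : ℕ) → List (MoldV n)
moldEnum n = src ∷ (lmap vin (allFin n) ++ lmap vout (allFin n))

module Submission where

-- (1) A move on v in G is simulated in Mold(G) by pebbling v^in, pebbling s, making the move on
-- v^out, and removing s and v^in again; the out-copies carry the configuration of G, so two extra
-- pebbles suffice. Acyclicity ensures v is not its own predecessor, so v^in can be removed.
-- (2) Conversely, a pebbling of Mold(G) is shadowed by a pebbling of G whose configuration C
-- contains every v with v^out pebbled and only vertices with some copy pebbled. C has to grow only
-- when some v^out is moved; then s and both copies of v are pebbled, so C can be completed to the
-- set of all pebbled vertices using two pebbles fewer than the current configuration. If every
-- configuration containing s had at most vis(G) + 1 pebbles, G could thus be visited in space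
-- vis(G) − 1.

open import Defs
open import Data.Bool using (Bool; true; false; not; _∧_; _∨_; if_then_else_)
open import Data.Bool.Properties using (∨-zeroʳ; ∨-identityʳ; ¬-not; not-involutive) renaming (_≟_ to _≟ᵇ_)
open import Data.Fin using (Fin; _≟_)
open import Data.List using (List; []; _∷_; _++_; map; allFin)
open import Data.List.Properties using (map-++; map-∘; map-cong)
open import Data.List.Membership.Propositional using (_∈_)
open import Data.List.Membership.Propositional.Properties using (∈-allFin)
open import Data.List.Relation.Unary.All using (All; []; _∷_) renaming (map to all-map)
open import Data.List.Relation.Unary.AllPairs using ([]; _∷_)
open import Data.List.Relation.Unary.Any using (here; there) renaming (tail to any-tail)
open import Data.List.Relation.Unary.Unique.Propositional using (Unique)
open import Data.List.Relation.Unary.Unique.Propositional.Properties using (allFin⁺)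
open import Data.Nat using (ℕ; zero; suc; _+_; _≤_; z≤n; s≤s; s≤s⁻¹; _≤?_)
open import Data.Nat.ListAction using (sum)
open import Data.Nat.ListAction.Properties using (sum-++)
open import Data.Nat.Properties
  using (module ≤-Reasoning; ≤-refl; ≤-trans; ≤-reflexive; <⇒≤; n≤1+n; m≤n+m; +-suc; +-comm;
         +-monoʳ-≤; +-mono-≤; ≰⇒>; 1+n≰n; anyUpTo?)
open import Data.Product using (Σ; _×_; _,_; proj₁; proj₂)
open import Data.Sum using (_⊎_; inj₁; inj₂)
open import Data.Vec.Functional using (updateAt)
open import Data.Vec.Functional.Properties using (updateAt-updates; updateAt-minimal)
open import Function using (_∘_; const)
open import Relation.Nullary using (yes; no; contradiction)
open import Relation.Nullary.Decidable using (_×-dec_)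
open import Relation.Binary.PropositionalEquality
  using (_≡_; _≢_; _≗_; refl; sym; trans; cong; cong₂; cong-app; subst; module ≡-Reasoning)
open import Relation.Binary.Construct.Closure.ReflexiveTransitive using (Star; ε; _◅_; _◅◅_)
open import Relation.Binary.Construct.Closure.Transitive using ([_])

∅ : {V : Set} → Config V
∅ _ = false

contraposeᵇ : {a b : Bool} → (a ≡ true → b ≡ true) → b ≡ false → a ≡ false
contraposeᵇ {false} _ _ = refl
contraposeᵇ {true} a⇒b b≡false with () ← trans (sym (a⇒b refl)) b≡false

module _ {V : Set} where

  size-cong : ∀ (l : List V) {P Q : Config V} → P ≗ Q → size l P ≡ size l Q
  size-cong l P≗Q = cong sum (map-cong (λ v → cong (if_then 1 else 0) (P≗Q v)) l)

  size-mono : ∀ (l : List V) {P Q : Config V} → (∀ v → P v ≡ true → Q v ≡ true) → size l P ≤ size l Q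
  size-mono [] P⊆Q = z≤n
  size-mono (x ∷ l) {P} {Q} P⊆Q with P x in px | Q x in qx
  ... | false | false = size-mono l P⊆Q
  ... | false | true  = ≤-trans (size-mono l P⊆Q) (n≤1+n _)
  ... | true  | true  = s≤s (size-mono l P⊆Q)
  ... | true  | false with () ← trans (sym (P⊆Q x px)) qx

  size-∅ : ∀ (l : List V) {m : ℕ} → size l ∅ ≤ m
  size-∅ [] = z≤n
  size-∅ (_ ∷ l) = size-∅ l

  size-≡0 : ∀ {l : List V} {P : Config V} → All (λ v → P v ≡ false) l → size l P ≡ 0
  size-≡0 [] = refl
  size-≡0 (Px≡false ∷ rest) rewrite Px≡false = size-≡0 rest

  size-pos : ∀ {l : List V} {P : Config V} {v : V} → v ∈ l → P v ≡ true → 1 ≤ size l P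
  size-pos (here refl) Pv rewrite Pv = s≤s z≤n
  size-pos {x ∷ _} {P} (there v∈l) Pv = ≤-trans (size-pos v∈l Pv) (m≤n+m _ (if P x then 1 else 0))

  size-≤1 : ∀ {l : List V} {P : Config V} {v : V} → Unique l → (∀ w → P w ≡ true → w ≡ v) → size l P ≤ 1
  size-≤1 [] _ = z≤n
  size-≤1 {x ∷ l} {P} (x∉l ∷ unique) only-v with P x in px
  ... | false = size-≤1 unique only-v
  ... | true = ≤-reflexive (cong suc (size-≡0 (all-map elsewhere x∉l)))
    where
    elsewhere : ∀ {w} → x ≢ w → P w ≡ false
    elsewhere x≢w = ¬-not (λ Pw → x≢w (trans (only-v x px) (sym (only-v _ Pw))))

  size-∨-∧ : ∀ (l : List V) (P Q : Config V)
           → size l (λ v → P v ∨ Q v) + size l (λ v → P v ∧ Q v) ≡ size l P + size l Q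
  size-∨-∧ [] P Q = refl
  size-∨-∧ (x ∷ l) P Q with P x | Q x
  ... | false | false = size-∨-∧ l P Q
  ... | false | true  = trans (cong suc (size-∨-∧ l P Q)) (sym (+-suc _ _))
  ... | true  | false = cong suc (size-∨-∧ l P Q)
  ... | true  | true  = cong suc (trans (+-suc _ _) (trans (cong suc (size-∨-∧ l P Q)) (sym (+-suc _ _))))

Toggles : {V : Set} → V → Config V → Config V → Set
Toggles v P Q = Q v ≡ not (P v) × (∀ w → w ≢ v → Q w ≡ P w)

toggles-sym : {V : Set} {v : V} {P Q : Config V} → Toggles v P Q → Toggles v Q P
toggles-sym {v = v} {P} (flip , others) =
  trans (sym (not-involutive (P v))) (cong not (sym flip)) , λ w w≢v → sym (others w w≢v)

toggles-some-true : {V : Set} {v : V} {P Q : Config V} → Toggles v P Q → P v ≡ true ⊎ Q v ≡ true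
toggles-some-true {v = v} {P} (flip , _) with P v
... | true = inj₁ refl
... | false = inj₂ flip

toggles-off-⊆ : {V : Set} {v : V} {P Q : Config V} → Toggles v P Q → P v ≡ true
              → ∀ w → Q w ≡ true → P w ≡ true
toggles-off-⊆ {v = v} {P} {Q} (_ , others) Pv w Qw with P w in Pw
... | true = refl
... | false = contradiction (trans (sym Qw) (trans (others w w≢v) Pw)) λ ()
  where
  w≢v : w ≢ v
  w≢v refl = contradiction (trans (sym Pv) Pw) λ ()

updateAt-toggles : ∀ {n} (C : Config (Fin n)) (v : Fin n) → Toggles v C (updateAt C v not)
updateAt-toggles C v = updateAt-updates v C , λ w w≢v → updateAt-minimal w v C w≢v

module BoundedWalk {V : Set} (E : V → V → Set) (enum : List V) (k : ℕ) where

  infix 4 _⟶_ _⟶*_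

  _⟶_ : Config V → Config V → Set
  A ⟶ B = Step E A B × size enum B ≤ k

  _⟶*_ : Config V → Config V → Set
  _⟶*_ = Star _⟶_

  ⟶*-size : ∀ {A C} → size enum A ≤ k → A ⟶* C → size enum C ≤ k
  ⟶*-size A≤k ε = A≤k
  ⟶*-size _ ((_ , B≤k) ◅ walk) = ⟶*-size B≤k walk

  walk⇒pebbling : ∀ {A C} → size enum A ≤ k → A ⟶* C
    → Σ ℕ λ τ → Σ (ℕ → Config V) λ P →
      IsPebbling E τ P × P 0 ≡ A × P τ ≡ C × SpaceAtMost enum τ P k
  walk⇒pebbling {A} A≤k ε = 0 , const A , (λ _ ()) , refl , refl , λ _ _ → A≤k
  walk⇒pebbling {A} A≤k ((step , B≤k) ◅ walk) with walk⇒pebbling B≤k walk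
  ... | τ , P , pebbling , refl , end , space = suc τ , P′ , pebbling′ , refl , end , space′
    where
    P′ : ℕ → Config V
    P′ zero = A
    P′ (suc t) = P t
    pebbling′ : IsPebbling E (suc τ) P′
    pebbling′ zero _ = step
    pebbling′ (suc t) t<τ = pebbling t (s≤s⁻¹ t<τ)
    space′ : SpaceAtMost enum (suc τ) P′ k
    space′ zero _ = A≤k
    space′ (suc t) t≤τ = space t (s≤s⁻¹ t≤τ)

visiting-space-pos : {V : Set} {E : V → V → Set} {enum : List V} {z : V} {k : ℕ}
  → z ∈ enum → HasVisitingPebbling E enum z k → 1 ≤ k
visiting-space-pos z∈enum (τ , _ , (_ , _ , z-pebbled) , space) =
  ≤-trans (size-pos z∈enum z-pebbled) (space τ ≤-refl)

module _ {n : ℕ} where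

  moldConf : Bool → Config (Fin n) → Config (Fin n) → Config (MoldV n)
  moldConf s I O src = s
  moldConf s I O (vin v) = I v
  moldConf s I O (vout v) = O v

  size-mold : (X : Config (MoldV n))
    → size (moldEnum n) X
      ≡ (if X src then 1 else 0) + (size (allFin n) (X ∘ vin) + size (allFin n) (X ∘ vout))
  size-mold X = cong ((if X src then 1 else 0) +_) (begin
    sum (map ind (map vin all ++ map vout all))
      ≡⟨ cong sum (map-++ ind (map vin all) (map vout all)) ⟩
    sum (map ind (map vin all) ++ map ind (map vout all))
      ≡⟨ sum-++ (map ind (map vin all)) _ ⟩
    sum (map ind (map vin all)) + sum (map ind (map vout all))
      ≡⟨ sym (cong₂ _+_ (cong sum (map-∘ all)) (cong sum (map-∘ all))) ⟩
    size all (X ∘ vin) + size all (X ∘ vout) ∎)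
    where
    open ≡-Reasoning
    all = allFin n
    ind : MoldV n → ℕ
    ind v = if X v then 1 else 0

  module _ (E : Fin n → Fin n → Set) {s : Bool} {I O : Config (Fin n)} where

    step-src : Step (MoldE E) (moldConf s I O) (moldConf (not s) I O)
    step-src = src , (λ _ ()) , refl , others
      where
      others : ∀ w → w ≢ src → moldConf (not s) I O w ≡ moldConf s I O w
      others src w≢src = contradiction refl w≢src
      others (vin _) _ = refl
      others (vout _) _ = refl

    step-in : ∀ {v I′} → (∀ u → E u v → O u ≡ true) → Toggles v I I′
            → Step (MoldE E) (moldConf s I O) (moldConf s I′ O)
    step-in {v} {I′} pre (flip , untouched) = vin v , pre′ , flip , others
      where
      pre′ : ∀ u → MoldE E u (vin v) → moldConf s I O u ≡ true
      pre′ _ (lift e) = pre _ e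
      others : ∀ w → w ≢ vin v → moldConf s I′ O w ≡ moldConf s I O w
      others src _ = refl
      others (vin w) w≢v = untouched w λ { refl → w≢v refl }
      others (vout _) _ = refl

    step-out : ∀ {v O′} → s ≡ true → I v ≡ true → Toggles v O O′
             → Step (MoldE E) (moldConf s I O) (moldConf s I O′)
    step-out {v} {O′} s≡true Iv (flip , untouched) = vout v , pre , flip , others
      where
      pre : ∀ u → MoldE E u (vout v) → moldConf s I O u ≡ true
      pre _ (in-out _) = Iv
      pre _ (from-s _) = s≡true
      others : ∀ w → w ≢ vout v → moldConf s I O′ w ≡ moldConf s I O w
      others src _ = refl
      others (vin _) _ = refl
      others (vout w) w≢v = untouched w λ { refl → w≢v refl }

module Persistent {n : ℕ} (E : Fin n → Fin n → Set) (acyclic : Acyclic E) (p : ℕ) where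

  open BoundedWalk (MoldE E) (moldEnum n) (2 + p)

  sing : Fin n → Config (Fin n)
  sing v = updateAt ∅ v not

  size-sing : ∀ v → size (allFin n) (sing v) ≤ 1
  size-sing v = size-≤1 (allFin⁺ n) only-v
    where
    only-v : ∀ w → sing v w ≡ true → w ≡ v
    only-v w sing-w with w ≟ v
    ... | yes w≡v = w≡v
    ... | no w≢v with () ← trans (sym (updateAt-minimal w v ∅ w≢v)) sing-w

  size-moldConf : ∀ {s I O} → size (allFin n) I ≤ 1 → size (allFin n) O ≤ p
                → size (moldEnum n) (moldConf s I O) ≤ 2 + p
  size-moldConf {s} {I} {O} I≤1 O≤p = begin
    size (moldEnum n) (moldConf s I O)
      ≡⟨ size-mold (moldConf s I O) ⟩
    (if s then 1 else 0) + (size (allFin n) I + size (allFin n) O)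
      ≤⟨ +-mono-≤ (indicator≤1 s) (+-mono-≤ I≤1 O≤p) ⟩
    2 + p ∎
    where
    open ≤-Reasoning
    indicator≤1 : ∀ b → (if b then 1 else 0) ≤ 1
    indicator≤1 true = s≤s z≤n
    indicator≤1 false = z≤n

  simulate-step : ∀ {C C′} → Step E C C′ → size (allFin n) C ≤ p → size (allFin n) C′ ≤ p
                → moldConf false ∅ C ⟶* moldConf false ∅ C′
  simulate-step {C} {C′} (v , pre , toggle) C≤p C′≤p =
      (step-in E pre (updateAt-toggles ∅ v) , size-moldConf (size-sing v) C≤p)
    ◅ (step-src E , size-moldConf (size-sing v) C≤p)
    ◅ (step-out E refl (updateAt-updates v ∅) toggle , size-moldConf (size-sing v) C′≤p)
    ◅ (step-src E , size-moldConf (size-sing v) C′≤p)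
    ◅ (step-in E pre′ (toggles-sym (updateAt-toggles ∅ v)) , size-moldConf (size-∅ (allFin n)) C′≤p)
    ◅ ε
    where
    pre′ : ∀ u → E u v → C′ u ≡ true
    pre′ u e with u ≟ v
    ... | yes refl = contradiction [ e ] (acyclic u)
    ... | no u≢v = trans (proj₂ toggle u u≢v) (pre u e)

  simulate : ∀ {τ P} → IsPebbling E τ P → SpaceAtMost (allFin n) τ P p
           → ∀ t → t ≤ τ → moldConf false ∅ (P 0) ⟶* moldConf false ∅ (P t)
  simulate _ _ zero _ = ε
  simulate pebbling space (suc t) t<τ =
    simulate pebbling space t (<⇒≤ t<τ)
    ◅◅ simulate-step (pebbling t t<τ) (space t (<⇒≤ t<τ)) (space (suc t) t<τ)

  mold-persistent : ∀ {z} → HasPersistentPebbling E (allFin n) z p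
                  → HasPersistentPebbling (MoldE E) (moldEnum n) (vout z) (2 + p)
  mold-persistent {z} (τ , P , (pebbling , empty , z-pebbled , only-z) , space)
    with walk⇒pebbling (size-moldConf (size-∅ (allFin n)) (space 0 z≤n)) (simulate pebbling space τ ≤-refl)
  ... | τ′ , P′ , pebbling′ , start , end , space′ =
    τ′ , P′ , (pebbling′ , empty′ , trans (cong-app end (vout z)) z-pebbled , only-z′) , space′
    where
    empty′ : EmptyConf (P′ 0)
    empty′ src = cong-app start src
    empty′ (vin w) = cong-app start (vin w)
    empty′ (vout w) = trans (cong-app start (vout w)) (empty w)
    only-z′ : ∀ w → P′ τ′ w ≡ true → w ≡ vout z
    only-z′ src e with () ← trans (sym (cong-app end src)) e
    only-z′ (vin w) e with () ← trans (sym (cong-app end (vin w))) e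
    only-z′ (vout w) e = cong vout (only-z w (trans (sym (cong-app end (vout w))) e))

mold-persistent-price : ∀ {n} (E : Fin n → Fin n → Set) (z : Fin n) → Acyclic E → ∀ {p q}
  → IsPersistentPrice E (allFin n) z p → IsPersistentPrice (MoldE E) (moldEnum n) (vout z) q
  → q ≤ p + 2
mold-persistent-price E z acyclic {p} {q} (has , _) (_ , minimal) =
  subst (q ≤_) (+-comm 2 p) (minimal (2 + p) (Persistent.mold-persistent E acyclic p has))

module _ {n : ℕ} (E : Fin n → Fin n → Set) (k : ℕ) where

  open BoundedWalk E (allFin n) k

  new-tail : ∀ {x : Fin n} {L : List (Fin n)} {C D : Config (Fin n)}
    → (∀ v → D v ≡ true → C v ≡ false → v ∈ x ∷ L × (∀ u → E u v → C u ≡ true))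
    → (∀ {v} → D v ≡ true → C v ≡ false → v ≢ x)
    → ∀ v → D v ≡ true → C v ≡ false → v ∈ L × (∀ u → E u v → C u ≡ true)
  new-tail new v≢x v Dv Cv with new v Dv Cv
  ... | v∈xL , pre = any-tail (v≢x Dv Cv) v∈xL , pre

  fill : ∀ (L : List (Fin n)) {C D : Config (Fin n)}
       → (∀ v → C v ≡ true → D v ≡ true)
       → (∀ v → D v ≡ true → C v ≡ false → v ∈ L × (∀ u → E u v → C u ≡ true))
       → size (allFin n) D ≤ k
       → Σ (Config (Fin n)) λ C′ → C ⟶* C′ × C′ ≗ D
  fill [] {C} {D} C⊆D new _ = C , ε , C≗D
    where
    C≗D : C ≗ D
    C≗D v with C v in Cv | D v in Dv
    ... | true  | true  = refl
    ... | false | false = refl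
    ... | true  | false with () ← trans (sym (C⊆D v Cv)) Dv
    ... | false | true  with () ← proj₁ (new v Dv Cv)
  fill (x ∷ L) {C} {D} C⊆D new D≤k with C x in Cx | D x in Dx
  ... | true  | _     = fill L C⊆D (new-tail new λ { _ Cx≡false refl → contradiction (trans (sym Cx) Cx≡false) λ () }) D≤k
  ... | false | false = fill L C⊆D (new-tail new λ { Dx≡true _ refl → contradiction (trans (sym Dx) Dx≡true) λ () }) D≤k
  ... | false | true =
    let C′ , walk , C′≗D = fill L C₁⊆D new₁ D≤k
    in C′ , (step , ≤-trans (size-mono (allFin n) C₁⊆D) D≤k) ◅ walk , C′≗D
    where
    C₁ : Config (Fin n)
    C₁ = updateAt C x not
    step : Step E C C₁
    step = x , proj₂ (new x Dx Cx) , updateAt-toggles C x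
    C⊆C₁ : ∀ v → C v ≡ true → C₁ v ≡ true
    C⊆C₁ v Cv with v ≟ x
    ... | yes refl with () ← trans (sym Cx) Cv
    ... | no v≢x = trans (updateAt-minimal v x C v≢x) Cv
    C₁⊆D : ∀ v → C₁ v ≡ true → D v ≡ true
    C₁⊆D v C₁v with v ≟ x
    ... | yes refl = Dx
    ... | no v≢x = C⊆D v (trans (sym (updateAt-minimal v x C v≢x)) C₁v)
    new₁ : ∀ v → D v ≡ true → C₁ v ≡ false → v ∈ L × (∀ u → E u v → C₁ u ≡ true)
    new₁ v Dv C₁v with v ≟ x
    ... | yes refl with () ← trans (sym (trans (updateAt-updates x C) (cong not Cx))) C₁v
    ... | no v≢x with new v Dv (trans (sym (updateAt-minimal v x C v≢x)) C₁v)
    ...   | v∈xL , pre = any-tail v≢x v∈xL , λ u e → C⊆C₁ u (pre u e)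

module Visiting {n : ℕ} (E : Fin n → Fin n → Set) (k : ℕ) where

  open BoundedWalk E (allFin n) k

  pebbled : Config (MoldV n) → Config (Fin n)
  pebbled X v = X (vin v) ∨ X (vout v)

  pebbled-in : ∀ {X v} → X (vin v) ≡ true → pebbled X v ≡ true
  pebbled-in {X} {v} Xin = cong (_∨ X (vout v)) Xin

  pebbled-out : ∀ {X v} → X (vout v) ≡ true → pebbled X v ≡ true
  pebbled-out {X} {v} Xout = trans (cong (X (vin v) ∨_) Xout) (∨-zeroʳ (X (vin v)))

  pebbled-in⁻ : ∀ {X v} → pebbled X v ≡ true → X (vout v) ≡ false → X (vin v) ≡ true
  pebbled-in⁻ {X} {v} pebbled-v Xout =
    trans (sym (∨-identityʳ (X (vin v)))) (trans (cong (X (vin v) ∨_) (sym Xout)) pebbled-v)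

  SourceBounded : Config (MoldV n) → Set
  SourceBounded X = X src ≡ true → size (moldEnum n) X ≤ 2 + k

  -- One pebble for s, one for v, whose two copies count only once in pebbled X.
  size-pebbled : ∀ {X v} → X src ≡ true → X (vin v) ≡ true → X (vout v) ≡ true
               → 2 + size (allFin n) (pebbled X) ≤ size (moldEnum n) X
  size-pebbled {X} {v} Xs Xin Xout = begin
    2 + size all (pebbled X)
      ≡⟨ cong suc (+-comm 1 _) ⟩
    1 + (size all (pebbled X) + 1)
      ≤⟨ +-monoʳ-≤ 1 (+-monoʳ-≤ (size all (pebbled X)) both-v) ⟩
    1 + (size all (pebbled X) + size all both)
      ≡⟨ cong (1 +_) (size-∨-∧ all (X ∘ vin) (X ∘ vout)) ⟩
    1 + copies
      ≡⟨ cong (λ b → (if b then 1 else 0) + copies) Xs ⟨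
    (if X src then 1 else 0) + copies
      ≡⟨ size-mold X ⟨
    size (moldEnum n) X ∎
    where
    open ≤-Reasoning
    all = allFin n
    copies : ℕ
    copies = size all (X ∘ vin) + size all (X ∘ vout)
    both : Config (Fin n)
    both w = X (vin w) ∧ X (vout w)
    both-v : 1 ≤ size all both
    both-v = size-pos (∈-allFin v) (cong₂ _∧_ Xin Xout)

  size-pebbled-≤ : ∀ {X v} → SourceBounded X → X src ≡ true → X (vin v) ≡ true → X (vout v) ≡ true
                  → size (allFin n) (pebbled X) ≤ k
  size-pebbled-≤ bounded Xs Xin Xout = s≤s⁻¹ (s≤s⁻¹ (≤-trans (size-pebbled Xs Xin Xout) (bounded Xs)))

  record Simulates (X : Config (MoldV n)) (C : Config (Fin n)) : Set where
    field
      out⇒C : ∀ v → X (vout v) ≡ true → C v ≡ true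
      C⇒pebbled : ∀ v → C v ≡ true → pebbled X v ≡ true
      in-ready : ∀ v → X (vin v) ≡ true → C v ≡ false → ∀ u → E u v → X (vout u) ≡ true

  pebbled-simulates : ∀ {X C} → C ≗ pebbled X → Simulates X C
  pebbled-simulates {X} {C} C≗pebbled = record
    { out⇒C = λ v Xout → trans (C≗pebbled v) (pebbled-out {X} Xout)
    ; C⇒pebbled = λ v Cv → trans (sym (C≗pebbled v)) Cv
    ; in-ready = λ v Xin Cv → contradiction (trans (sym (trans (C≗pebbled v) (pebbled-in {X} Xin))) Cv) λ ()
    }

  module _ {X X′ : Config (MoldV n)} {v : Fin n} {C : Config (Fin n)}
           (pre : ∀ u → MoldE E u (vin v) → X u ≡ true) (toggle : Toggles (vin v) X X′)
           (sim : Simulates X C) where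

    open Simulates sim

    private
      outs : ∀ w → X′ (vout w) ≡ X (vout w)
      outs w = proj₂ toggle (vout w) λ ()

      ins : ∀ {w} → w ≢ v → X′ (vin w) ≡ X (vin w)
      ins w≢v = proj₂ toggle (vin _) λ { refl → w≢v refl }

      pebbled-elsewhere : ∀ {w} → w ≢ v → pebbled X′ w ≡ pebbled X w
      pebbled-elsewhere {w} w≢v = cong₂ _∨_ (ins w≢v) (outs w)

    simulates-in-keep : (C v ≡ true → X (vout v) ≡ true) → Simulates X′ C
    simulates-in-keep keep = record
      { out⇒C = λ w Xout → out⇒C w (trans (sym (outs w)) Xout)
      ; C⇒pebbled = C⇒pebbled′
      ; in-ready = in-ready′
      }
      where
      C⇒pebbled′ : ∀ w → C w ≡ true → pebbled X′ w ≡ true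
      C⇒pebbled′ w Cw with w ≟ v
      ... | yes refl = pebbled-out {X′} (trans (outs w) (keep Cw))
      ... | no w≢v = trans (pebbled-elsewhere w≢v) (C⇒pebbled w Cw)
      in-ready′ : ∀ w → X′ (vin w) ≡ true → C w ≡ false → ∀ u → E u w → X′ (vout u) ≡ true
      in-ready′ w X′in Cw u e with w ≟ v
      ... | yes refl = trans (outs u) (pre (vout u) (lift e))
      ... | no w≢v = trans (outs u) (in-ready w (trans (sym (ins w≢v)) X′in) Cw u e)

    simulates-in-remove : C v ≡ true → X (vout v) ≡ false
                        → Step E C (updateAt C v not) × Simulates X′ (updateAt C v not)
    simulates-in-remove Cv Xout =
      (v , (λ u e → out⇒C u (pre (vout u) (lift e))) , updateAt-toggles C v) , record
      { out⇒C = out⇒C′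
      ; C⇒pebbled = C⇒pebbled′
      ; in-ready = in-ready′
      }
      where
      C′ = updateAt C v not
      C′v : C′ v ≡ false
      C′v = trans (updateAt-updates v C) (cong not Cv)
      C′-elsewhere : ∀ {w} → w ≢ v → C′ w ≡ C w
      C′-elsewhere {w} = updateAt-minimal w v C
      X′in : X′ (vin v) ≡ false
      X′in = trans (proj₁ toggle) (cong not (pebbled-in⁻ {X} (C⇒pebbled v Cv) Xout))
      out⇒C′ : ∀ w → X′ (vout w) ≡ true → C′ w ≡ true
      out⇒C′ w X′out with w ≟ v
      ... | yes refl with () ← trans (sym Xout) (trans (sym (outs w)) X′out)
      ... | no w≢v = trans (C′-elsewhere w≢v) (out⇒C w (trans (sym (outs w)) X′out))
      C⇒pebbled′ : ∀ w → C′ w ≡ true → pebbled X′ w ≡ true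
      C⇒pebbled′ w C′w with w ≟ v
      ... | yes refl with () ← trans (sym C′v) C′w
      ... | no w≢v = trans (pebbled-elsewhere w≢v) (C⇒pebbled w (trans (sym (C′-elsewhere w≢v)) C′w))
      in-ready′ : ∀ w → X′ (vin w) ≡ true → C′ w ≡ false → ∀ u → E u w → X′ (vout u) ≡ true
      in-ready′ w X′in-w C′w u e with w ≟ v
      ... | yes refl with () ← trans (sym X′in) X′in-w
      ... | no w≢v =
        trans (outs u) (in-ready w (trans (sym (ins w≢v)) X′in-w) (trans (sym (C′-elsewhere w≢v)) C′w) u e)

  module _ {X X′ : Config (MoldV n)} {v : Fin n} {C : Config (Fin n)}
           (pre : ∀ u → MoldE E u (vout v) → X u ≡ true) (toggle : Toggles (vout v) X X′)
           (sim : Simulates X C) where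

    open Simulates sim

    private
      Xs : X src ≡ true
      Xs = pre src (from-s v)

      Xin : X (vin v) ≡ true
      Xin = pre (vin v) (in-out v)

      pebbled-same : pebbled X′ ≗ pebbled X
      pebbled-same w with w ≟ v
      ... | yes refl = trans (pebbled-in {X′} (trans (proj₂ toggle (vin w) λ ()) Xin)) (sym (pebbled-in {X} Xin))
      ... | no w≢v = cong₂ _∨_ (proj₂ toggle (vin w) λ ()) (proj₂ toggle (vout w) λ { refl → w≢v refl })

      size-pebbled′-≤ : SourceBounded X → SourceBounded X′ → size (allFin n) (pebbled X′) ≤ k
      size-pebbled′-≤ bX bX′ with toggles-some-true toggle
      ... | inj₁ Xout = ≤-trans (≤-reflexive (size-cong (allFin n) pebbled-same)) (size-pebbled-≤ bX Xs Xin Xout)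
      ... | inj₂ X′out = size-pebbled-≤ bX′ (trans (proj₂ toggle src λ ()) Xs)
                                            (trans (proj₂ toggle (vin v) λ ()) Xin) X′out

    simulates-out : SourceBounded X → SourceBounded X′
                  → Σ (Config (Fin n)) λ C′ → C ⟶* C′ × Simulates X′ C′
    simulates-out bX bX′ =
      let C′ , walk , C′≗pebbled = fill E k (allFin n) C⊆pebbled new (size-pebbled′-≤ bX bX′)
      in C′ , walk , pebbled-simulates C′≗pebbled
      where
      C⊆pebbled : ∀ w → C w ≡ true → pebbled X′ w ≡ true
      C⊆pebbled w Cw = trans (pebbled-same w) (C⇒pebbled w Cw)
      new : ∀ w → pebbled X′ w ≡ true → C w ≡ false → w ∈ allFin n × (∀ u → E u w → C u ≡ true)
      new w pebbled-w Cw = ∈-allFin w , λ u e → out⇒C u (in-ready w Xin-w Cw u e)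
        where
        Xin-w : X (vin w) ≡ true
        Xin-w = pebbled-in⁻ {X} (trans (sym (pebbled-same w)) pebbled-w) (contraposeᵇ (out⇒C w) Cw)

  simulates-src : ∀ {X X′ C} → Toggles src X X′ → Simulates X C → Simulates X′ C
  simulates-src {X} {X′} (_ , others) sim = record
    { out⇒C = λ w Xout → out⇒C w (trans (sym (others (vout w) λ ())) Xout)
    ; C⇒pebbled = λ w Cw → trans (cong₂ _∨_ (others (vin w) λ ()) (others (vout w) λ ())) (C⇒pebbled w Cw)
    ; in-ready = λ w Xin Cw u e →
        trans (others (vout u) λ ()) (in-ready w (trans (sym (others (vin w) λ ())) Xin) Cw u e)
    }
    where open Simulates sim

  simulate-step : ∀ {X X′ C} → SourceBounded X → SourceBounded X′ → size (allFin n) C ≤ k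
                → Step (MoldE E) X X′ → Simulates X C
                → Σ (Config (Fin n)) λ C′ → C ⟶* C′ × Simulates X′ C′
  simulate-step _ _ _ (src , _ , toggle) sim = _ , ε , simulates-src toggle sim
  simulate-step {X} {C = C} _ _ C≤k (vin v , pre , toggle) sim with C v in Cv | X (vout v) in Xout
  ... | true | false =
    let step , sim′ = simulates-in-remove pre toggle sim Cv Xout
    in _ , (step , ≤-trans (size-mono (allFin n) (toggles-off-⊆ (proj₂ (proj₂ step)) Cv)) C≤k) ◅ ε , sim′
  ... | true | true = _ , ε , simulates-in-keep pre toggle sim (λ _ → Xout)
  ... | false | _ = _ , ε , simulates-in-keep pre toggle sim λ Cv′ → contradiction (trans (sym Cv) Cv′) λ ()
  simulate-step bX bX′ _ (vout v , pre , toggle) sim = simulates-out pre toggle sim bX bX′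

  simulate : ∀ {τ P} → IsPebbling (MoldE E) τ P → EmptyConf (P 0) → (∀ t → t ≤ τ → SourceBounded (P t))
           → ∀ t → t ≤ τ → Σ (Config (Fin n)) λ C → ∅ ⟶* C × Simulates (P t) C
  simulate _ empty _ zero _ =
    ∅ , ε , pebbled-simulates (λ w → sym (cong₂ _∨_ (empty (vin w)) (empty (vout w))))
  simulate pebbling empty bounded (suc t) t<τ with simulate pebbling empty bounded t (<⇒≤ t<τ)
  ... | C , walk , sim =
    let C′ , walk′ , sim′ = simulate-step (bounded t (<⇒≤ t<τ)) (bounded (suc t) t<τ)
                                          (⟶*-size (size-∅ (allFin n)) walk) (pebbling t t<τ) sim
    in C′ , walk ◅◅ walk′ , sim′

  mold-visiting⇒visiting : ∀ {z τ P} → IsVisitingPebbling (MoldE E) (vout z) τ P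
                         → (∀ t → t ≤ τ → SourceBounded (P t)) → HasVisitingPebbling E (allFin n) z k
  mold-visiting⇒visiting {z} {τ} (pebbling , empty , z-pebbled) bounded
    with simulate pebbling empty bounded τ ≤-refl
  ... | C , walk , sim with walk⇒pebbling (size-∅ (allFin n)) walk
  ...   | τ′ , P′ , pebbling′ , start , end , space =
    τ′ , P′ , (pebbling′ , cong-app start , trans (cong-app end z) (Simulates.out⇒C sim z z-pebbled)) , space

mold-visiting-space : ∀ {n} (E : Fin n → Fin n → Set) (z : Fin n) {vis : ℕ}
  → IsVisitingPrice E (allFin n) z vis
  → ∀ {τ P} → IsVisitingPebbling (MoldE E) (vout z) τ P
  → Σ ℕ λ b → b ≤ τ × P b src ≡ true × vis + 2 ≤ size (moldEnum n) (P b)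
mold-visiting-space E z {zero} (has , _) _ = contradiction (visiting-space-pos (∈-allFin z) has) λ ()
mold-visiting-space {n} E z {suc m} (_ , minimal) {τ} {P} visiting
  with anyUpTo? (λ b → P b src ≟ᵇ true ×-dec suc m + 2 ≤? size (moldEnum n) (P b)) (suc τ)
... | yes (b , b<1+τ , Pb-src , large) = b , s≤s⁻¹ b<1+τ , Pb-src , large
... | no none = contradiction (minimal m (Visiting.mold-visiting⇒visiting E m visiting bounded)) 1+n≰n
  where
  bounded : ∀ t → t ≤ τ → Visiting.SourceBounded E m (P t)
  bounded t t≤τ Pt-src = ≤-trans (s≤s⁻¹ (≰⇒> λ large → none (t , s≤s t≤τ , Pt-src , large)))
                                 (≤-reflexive (+-comm m 2))

lemma6p6 : (n : ℕ) (E : Fin n → Fin n → Set) (z : Fin n)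
  → Acyclic E → UniqueSink E z
  → ((p q : ℕ)
      → IsPersistentPrice E (allFin n) z p
      → IsPersistentPrice (MoldE E) (moldEnum n) (vout z) q
      → q ≤ p + 2)
  × ((vis : ℕ) → IsVisitingPrice E (allFin n) z vis
      → (τ : ℕ) (P : ℕ → Config (MoldV n))
      → IsVisitingPebbling (MoldE E) (vout z) τ P
      → Σ ℕ λ b → b ≤ τ × P b src ≡ true × vis + 2 ≤ size (moldEnum n) (P b))
lemma6p6 n E z acyclic _ =
  (λ _ _ → mold-persistent-price E z acyclic) ,
  (λ _ price _ _ → mold-visiting-space E z price)
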